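{- Let $m>1$ and $n\ge1$ be integers, and let $SF(n,m)$ be the set of semi-$m$-Fibonacci partitions of $n$ (defined in the context). For a positive integer $N$, let $x_m(N)=m^s$ where $s\ge0$ is the largest integer with $m^s\mid N$. Then a partition $\lambda$ of $n$ belongs to $SF(n,m)$ if and only if the parts of $\lambda$ have pairwise distinct values of $x_m$ and at most one part of $\lambda$ is not a multiple of $m$.
   Context: For fixed $m>1$, the sets $SF(n,m)$ of partitions of $n$ ($n\ge1$) are defined recursively: $SF(n,m)=\{(n)\}$ for $n=1,\dots,m$. If $n>m$ and $m\mid n$, then $SF(n,m)$ consists of the partitions obtained from the partitions in $SF(n/m,m)$ by multiplying every part by $m$. If $n>m$ and $n\equiv r\pmod m$ with $1\le r\le m-1$, then $SF(n,m)$ consists of (a) the partitions obtained by inserting a part $r$ into a partition of $SF(n-r,m)$, together with (b) the partitions obtained from a partition $\lambda\in SF(n-m,m)$ by adding $m$ to the single part of $\lambda$ that is congruent to $r$ modulo $m$ (each such $\lambda$ has exactly one such part). -}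

module Defs where

open import Data.Nat using (ℕ; zero; suc; _+_; _*_; _∸_; _^_; _≤_; _<_)
open import Data.Nat.Divisibility using (_∣_; _∣?_)
open import Data.List using (List; []; _∷_; [_]; _++_; map; filter; length)
open import Data.Nat.ListAction using (sum)
open import Data.List.Relation.Unary.All using (All)
open import Data.List.Relation.Unary.AllPairs using (AllPairs)
open import Data.List.Relation.Binary.Permutation.Propositional using (_↭_)
open import Data.Product using (Σ; ∃; _×_)
open import Relation.Nullary using (¬_; ¬?)
open import Relation.Binary.PropositionalEquality using (_≡_)

-- A partition is represented as a list of parts (order irrelevant; membership
-- in SF is taken up to permutation).
-- λ is a partition of n: all parts positive and they sum to n.
IsPartition : ℕ → List ℕ → Set
IsPartition n λs = All (λ p → 1 ≤ p) λs × sum λs ≡ n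

_≡_[mod_] : ℕ → ℕ → ℕ → Set
n ≡ r [mod m ] = Σ ℕ (λ q → n ≡ q * m + r)

data Gen (m : ℕ) : ℕ → List ℕ → Set where
  base : ∀ n → 1 ≤ n → n ≤ m → Gen m n [ n ]
  mult : ∀ k μ → m < m * k → Gen m k μ → Gen m (m * k) (map (m *_) μ)
  ins : ∀ n r μ → m < n → 1 ≤ r → r < m → n ≡ r [mod m ] →
        Gen m (n ∸ r) μ → Gen m n (r ∷ μ)
  add : ∀ n r xs p ys → m < n → 1 ≤ r → r < m → n ≡ r [mod m ] →
        p ≡ r [mod m ] → Gen m (n ∸ m) (xs ++ p ∷ ys) →
        Gen m n (xs ++ (p + m) ∷ ys)

_∈SF[_,_] : List ℕ → ℕ → ℕ → Set
λs ∈SF[ n , m ] = Σ (List ℕ) (λ μ → Gen m n μ × μ ↭ λs)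

IsXm : ℕ → ℕ → ℕ → Set
IsXm m N y = Σ ℕ (λ s → y ≡ m ^ s × (m ^ s ∣ N) × ¬ (m ^ suc s ∣ N))

DistinctXm : ℕ → List ℕ → Set
DistinctXm m λs = AllPairs (λ a b → ∀ y z → IsXm m a y → IsXm m b z → ¬ (y ≡ z)) λs

nonMultiples : ℕ → List ℕ → ℕ
nonMultiples m λs = length (filter (λ p → ¬? (m ∣? p)) λs)

-- Non-multiples of m are exactly the parts with x_m = 1, and x_m (m a) = m x_m (a).
-- So "distinct x_m" already allows at most one non-multiple, and the multiples,
-- divided by m, again have distinct x_m. Every generating rule preserves this,
-- the inserted part r, or the part that receives m, being the unique non-multiple.
-- Conversely, by strong induction on n: for n ≤ m only (n) qualifies; if m ∣ n all
-- parts are multiples and we divide by m; otherwise the unique non-multiple part p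
-- satisfies p ≡ n (mod m), so either p = r (undo an insertion) or p > m (undo an
-- addition of m).
module Submission where

open import Defs
open import Data.Nat using (ℕ; zero; suc; _+_; _*_; _∸_; _^_; _≤_; _<_; z≤n; s≤s; NonZero; >-nonZero; >-nonZero⁻¹; _≤?_)
open import Data.Nat.Properties
open import Algebra.Properties.CommutativeSemigroup +-commutativeSemigroup using (xy∙z≈xz∙y)
open import Data.Nat.Divisibility using (_∣_; _∤_; _∣?_; divides; 1∣_; ∣-refl; ∣-trans; m∣m*n; n∣m*n; >⇒∤; ∣m+n∣m⇒∣n; ∣m∣n⇒∣m+n; *-monoʳ-∣; *-cancelˡ-∣)
open import Data.Nat.DivMod using (_%_; _/_; m≡m%n+[m/n]*n; [m+kn]%n≡m%n; m<n⇒m%n≡m; m%n<n)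
open import Data.Nat.Induction using (<-Rec; <-rec)
open import Data.Nat.ListAction using (sum)
open import Data.Nat.ListAction.Properties using (sum-↭)
open import Data.List using (List; []; _∷_; [_]; _++_; map; length)
open import Data.List.Properties using (filter-accept; filter-none)
open import Data.List.Membership.Propositional.Properties using (∈-∃++)
open import Data.List.Relation.Unary.Any using (here)
open import Data.List.Relation.Unary.All as All using (All; []; _∷_)
import Data.List.Relation.Unary.All.Properties as All
open import Data.List.Relation.Unary.AllPairs as AllPairs using (AllPairs; []; _∷_)
import Data.List.Relation.Unary.AllPairs.Properties as AllPairs
open import Data.List.Relation.Binary.Permutation.Propositional using (_↭_; refl; prep; swap; ↭-sym; ↭-trans; ↭-refl; ↭-reflexive)
open import Data.List.Relation.Binary.Permutation.Propositional.Properties as ↭ using (All-resp-↭; ∈-resp-↭; filter-↭; ↭-length; shift; drop-∷)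
open import Data.Product using (∃-syntax; ∃₂; _×_; _,_; proj₁; proj₂)
open import Data.Sum using (_⊎_; inj₁; inj₂)
open import Data.Empty using (⊥-elim)
open import Function.Bundles using (_⇔_; mk⇔; Equivalence)
open import Relation.Binary.Core using (Rel)
open import Relation.Binary.Definitions using (Symmetric)
open import Relation.Unary using (Decidable)
open import Relation.Nullary using (¬_; ¬?; yes; no; contradiction)
open import Relation.Binary.PropositionalEquality using (_≡_; _≢_; refl; sym; trans; cong; subst; module ≡-Reasoning)
open import Level using (Level)

private variable
  ℓ ℓ′ : Level
  A : Set ℓ
  m n k a b p r y : ℕ
  xs μ rest : List ℕ

allPairs-resp-↭ : {R : Rel A ℓ′} → Symmetric R → {xs ys : List A} →
                  xs ↭ ys → AllPairs R xs → AllPairs R ys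
allPairs-resp-↭ sym-R refl                rs = rs
allPairs-resp-↭ sym-R (prep x p)          (rx ∷ rs) = All-resp-↭ p rx ∷ allPairs-resp-↭ sym-R p rs
allPairs-resp-↭ sym-R (swap x y p)        ((rxy ∷ rx) ∷ ry ∷ rs) =
  (sym-R rxy ∷ All-resp-↭ p ry) ∷ All-resp-↭ p rx ∷ allPairs-resp-↭ sym-R p rs
allPairs-resp-↭ sym-R (_↭_.trans p₁ p₂) rs =
  allPairs-resp-↭ sym-R p₂ (allPairs-resp-↭ sym-R p₁ rs)

all-∣⇒∣-sum : All (m ∣_) xs → m ∣ sum xs
all-∣⇒∣-sum []       = divides 0 refl
all-∣⇒∣-sum (d ∷ ds) = ∣m∣n⇒∣m+n d (all-∣⇒∣-sum ds)

sum-map-*ˡ : ∀ m μ → sum (map (m *_) μ) ≡ m * sum μ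
sum-map-*ˡ m []      = sym (*-zeroʳ m)
sum-map-*ˡ m (a ∷ μ) = begin
  m * a + sum (map (m *_) μ) ≡⟨ cong (m * a +_) (sum-map-*ˡ m μ) ⟩
  m * a + m * sum μ          ≡⟨ *-distribˡ-+ m a (sum μ) ⟨
  m * (a + sum μ)            ∎
  where open ≡-Reasoning

all-∣⇒map-*ˡ : ∀ xs → All (m ∣_) xs → ∃[ μ ] map (m *_) μ ≡ xs
all-∣⇒map-*ˡ []       []                      = [] , refl
all-∣⇒map-*ˡ (a ∷ xs) (divides q a≡q*m ∷ ds) with all-∣⇒map-*ˡ xs ds
... | μ , refl = q ∷ μ , cong (_∷ xs) (trans (*-comm _ q) (sym a≡q*m))

multiples-or-nonMultiple : ∀ m xs → All (m ∣_) xs ⊎ ∃₂ λ p rest → xs ↭ p ∷ rest × m ∤ p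
multiples-or-nonMultiple m []       = inj₁ []
multiples-or-nonMultiple m (a ∷ xs) with m ∣? a
... | no m∤a = inj₂ (a , xs , ↭-refl , m∤a)
... | yes m∣a with multiples-or-nonMultiple m xs
...   | inj₁ ms                    = inj₁ (m∣a ∷ ms)
...   | inj₂ (p , rest , xs↭ , m∤p) = inj₂ (p , a ∷ rest , ↭-trans (prep a xs↭) (swap a p ↭-refl) , m∤p)

nonMultiple? : ∀ m → Decidable (m ∤_)
nonMultiple? m a = ¬? (m ∣? a)

nonMultiples-↭ : {xs ys : List ℕ} → xs ↭ ys → nonMultiples m xs ≡ nonMultiples m ys
nonMultiples-↭ {m = m} xs↭ys = ↭-length (filter-↭ (nonMultiple? m) xs↭ys)

nonMultiples-∷-nonMultiple : m ∤ p → nonMultiples m (p ∷ xs) ≡ suc (nonMultiples m xs)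
nonMultiples-∷-nonMultiple {m = m} m∤p = cong length (filter-accept (nonMultiple? m) m∤p)

all-∣⇒nonMultiples≡0 : All (m ∣_) xs → nonMultiples m xs ≡ 0
all-∣⇒nonMultiples≡0 {m = m} multiples =
  cong length (filter-none (nonMultiple? m) (All.map (λ m∣a m∤a → m∤a m∣a) multiples))

small-nonMultiple : 1 ≤ a → a < m → m ∤ a
small-nonMultiple {a = suc _} _ a<m = >⇒∤ a<m

residue-nonMultiple : 1 ≤ r → r < m → p ≡ r [mod m ] → m ∤ p
residue-nonMultiple 1≤r r<m (q , refl) m∣p = small-nonMultiple 1≤r r<m (∣m+n∣m⇒∣n m∣p (n∣m*n q))

1≤m*n⇒1≤n : ∀ m → 1 ≤ m * n → 1 ≤ n
1≤m*n⇒1≤n {n = n} m 1≤mn = >-nonZero⁻¹ n {{m*n≢0⇒n≢0 m {{>-nonZero 1≤mn}}}}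

≡[mod]-% : ∀ n .{{_ : NonZero m}} → n ≡ n % m [mod m ]
≡[mod]-% {m = m} n = n / m , trans (m≡m%n+[m/n]*n n m) (+-comm (n % m) _)

residue-+-multiple : .{{_ : NonZero m}} → r < m → (p + k * m) ≡ r [mod m ] → p ≡ r [mod m ]
residue-+-multiple {m = m} {r = r} {p = p} {k = k} r<m (q , e) = p / m , (begin
  p                 ≡⟨ m≡m%n+[m/n]*n p m ⟩
  p % m + p / m * m ≡⟨ cong (_+ p / m * m) p%m≡r ⟩
  r + p / m * m     ≡⟨ +-comm r _ ⟩
  p / m * m + r     ∎)
  where
  open ≡-Reasoning
  p%m≡r : p % m ≡ r
  p%m≡r = begin
    p % m           ≡⟨ [m+kn]%n≡m%n p k m ⟨
    (p + k * m) % m ≡⟨ cong (_% m) e ⟩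
    (q * m + r) % m ≡⟨ cong (_% m) (+-comm (q * m) r) ⟩
    (r + q * m) % m ≡⟨ [m+kn]%n≡m%n r q m ⟩
    r % m           ≡⟨ m<n⇒m%n≡m r<m ⟩
    r               ∎

isXm-nonMultiple : m ∤ a → IsXm m a 1
isXm-nonMultiple {m = m} {a = a} m∤a =
  0 , refl , 1∣ a , λ m*1∣a → m∤a (subst (_∣ a) (*-identityʳ m) m*1∣a)

isXm-nonMultiple⇒≡1 : m ∤ a → IsXm m a y → y ≡ 1
isXm-nonMultiple⇒≡1 _   (zero  , y≡1 , _)        = y≡1
isXm-nonMultiple⇒≡1 m∤a (suc s , _ , m^1+s∣a , _) = contradiction (∣-trans (m∣m*n _) m^1+s∣a) m∤a

isXm-multiple⇒≢1 : 1 < m → m ∣ a → IsXm m a y → y ≢ 1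
isXm-multiple⇒≢1 {m = m} {a = a} _ m∣a (zero , _ , _ , m*1∤a) _ =
  m*1∤a (subst (_∣ a) (sym (*-identityʳ m)) m∣a)
isXm-multiple⇒≢1 {m = m} 1<m _ (suc s , y≡m^1+s , _ , _) y≡1 =
  <⇒≢ 1<m (sym (m*n≡1⇒m≡1 m (m ^ s) (trans (sym y≡m^1+s) y≡1)))

isXm-*ˡ : .{{_ : NonZero m}} → IsXm m a y → IsXm m (m * a) (m * y)
isXm-*ˡ {m = m} (s , y≡m^s , m^s∣a , m^1+s∤a) =
  suc s , cong (m *_) y≡m^s , *-monoʳ-∣ m m^s∣a , λ m^2+s∣ma → m^1+s∤a (*-cancelˡ-∣ m m^2+s∣ma)

isXm-*ˡ⁻¹ : .{{_ : NonZero m}} → IsXm m (m * a) y → ∃[ y′ ] y ≡ m * y′ × IsXm m a y′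
isXm-*ˡ⁻¹ {m = m} {a = a} (zero , _ , _ , m*1∤ma) = contradiction (*-monoʳ-∣ m (1∣ a)) m*1∤ma
isXm-*ˡ⁻¹ {m = m} (suc s , y≡m^1+s , m^1+s∣ma , m^2+s∤ma) =
  m ^ s , y≡m^1+s , s , refl , *-cancelˡ-∣ m m^1+s∣ma , λ m^1+s∣a → m^2+s∤ma (*-monoʳ-∣ m m^1+s∣a)

XmApart : ℕ → ℕ → ℕ → Set
XmApart m a b = ∀ y z → IsXm m a y → IsXm m b z → ¬ (y ≡ z)

xmApart-sym : Symmetric (XmApart m)
xmApart-sym apart y z xb xa y≡z = apart z y xa xb (sym y≡z)

xmApart-nonMultiple-multiple : 1 < m → m ∤ a → m ∣ b → XmApart m a b
xmApart-nonMultiple-multiple 1<m m∤a m∣b y z xa xb y≡z =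
  isXm-multiple⇒≢1 1<m m∣b xb (trans (sym y≡z) (isXm-nonMultiple⇒≡1 m∤a xa))

nonMultiples-¬xmApart : m ∤ a → m ∤ b → ¬ XmApart m a b
nonMultiples-¬xmApart m∤a m∤b apart = apart 1 1 (isXm-nonMultiple m∤a) (isXm-nonMultiple m∤b) refl

xmApart-nonMultiple⇒multiple : m ∤ a → XmApart m a b → m ∣ b
xmApart-nonMultiple⇒multiple {m = m} {b = b} m∤a apart with m ∣? b
... | yes m∣b = m∣b
... | no  m∤b = contradiction apart (nonMultiples-¬xmApart m∤a m∤b)

xmApart-*ˡ : .{{_ : NonZero m}} → XmApart m a b → XmApart m (m * a) (m * b)
xmApart-*ˡ {m = m} apart y z xa xb y≡z with isXm-*ˡ⁻¹ xa | isXm-*ˡ⁻¹ xb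
... | y′ , y≡my′ , xa′ | z′ , z≡mz′ , xb′ =
  apart y′ z′ xa′ xb′ (*-cancelˡ-≡ y′ z′ m (trans (sym y≡my′) (trans y≡z z≡mz′)))

xmApart-*ˡ⁻¹ : .{{_ : NonZero m}} → XmApart m (m * a) (m * b) → XmApart m a b
xmApart-*ˡ⁻¹ {m = m} apart y z xa xb y≡z =
  apart (m * y) (m * z) (isXm-*ˡ xa) (isXm-*ˡ xb) (cong (m *_) y≡z)

distinctXm-↭ : {xs ys : List ℕ} → xs ↭ ys → DistinctXm m xs → DistinctXm m ys
distinctXm-↭ = allPairs-resp-↭ xmApart-sym

distinctXm-map-*ˡ : .{{_ : NonZero m}} → DistinctXm m μ → DistinctXm m (map (m *_) μ)
distinctXm-map-*ˡ distinct = AllPairs.map⁺ (AllPairs.map xmApart-*ˡ distinct)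

distinctXm-map-*ˡ⁻¹ : .{{_ : NonZero m}} → DistinctXm m (map (m *_) μ) → DistinctXm m μ
distinctXm-map-*ˡ⁻¹ distinct = AllPairs.map xmApart-*ˡ⁻¹ (AllPairs.map⁻ distinct)

gen-sum : Gen m n μ → sum μ ≡ n
gen-sum (base n _ _)                 = +-identityʳ n
gen-sum {m = m} (mult k μ _ g)       = trans (sum-map-*ˡ m μ) (cong (m *_) (gen-sum g))
gen-sum (ins n r μ m<n _ r<m _ g)    = trans (cong (r +_) (gen-sum g)) (m+[n∸m]≡n (<⇒≤ (<-trans r<m m<n)))
gen-sum {m = m} (add n r xs p ys m<n _ _ _ _ g) = begin
  sum (xs ++ (p + m) ∷ ys)  ≡⟨ sum-↭ (shift (p + m) xs ys) ⟩
  p + m + sum (xs ++ ys)    ≡⟨ xy∙z≈xz∙y p m _ ⟩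
  sum (p ∷ xs ++ ys) + m    ≡⟨ cong (_+ m) (sum-↭ (shift p xs ys)) ⟨
  sum (xs ++ p ∷ ys) + m    ≡⟨ cong (_+ m) (gen-sum g) ⟩
  n ∸ m + m                 ≡⟨ m∸n+n≡m (<⇒≤ m<n) ⟩
  n                         ∎
  where open ≡-Reasoning

isPartition-↭ : {xs ys : List ℕ} → xs ↭ ys → IsPartition n xs → IsPartition n ys
isPartition-↭ xs↭ys (positive , sum≡n) = All-resp-↭ xs↭ys positive , trans (sym (sum-↭ xs↭ys)) sum≡n

∈SF-↭ : {λs λs′ : List ℕ} → λs ∈SF[ n , m ] → λs ↭ λs′ → λs′ ∈SF[ n , m ]
∈SF-↭ (μ , g , μ↭λs) λs↭λs′ = μ , g , ↭-trans μ↭λs λs↭λs′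

∈SF-mult : m < m * k → μ ∈SF[ k , m ] → map (m *_) μ ∈SF[ m * k , m ]
∈SF-mult {m = m} {k = k} m<mk (ν , g , ν↭μ) = map (m *_) ν , mult k ν m<mk g , ↭.map⁺ (m *_) ν↭μ

∈SF-ins : m < n → 1 ≤ r → r < m → n ≡ r [mod m ] → μ ∈SF[ n ∸ r , m ] → (r ∷ μ) ∈SF[ n , m ]
∈SF-ins {n = n} {r = r} m<n 1≤r r<m n≡r (ν , g , ν↭μ) = r ∷ ν , ins n r ν m<n 1≤r r<m n≡r g , prep r ν↭μ

∈SF-add : m < n → 1 ≤ r → r < m → n ≡ r [mod m ] → p ≡ r [mod m ] →
          (p ∷ μ) ∈SF[ n ∸ m , m ] → ((p + m) ∷ μ) ∈SF[ n , m ]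
∈SF-add {m = m} {n = n} {r = r} {p = p} {μ = μ} m<n 1≤r r<m n≡r p≡r (ν , g , ν↭p∷μ)
  with ∈-∃++ (∈-resp-↭ (↭-sym ν↭p∷μ) (here refl))
... | xs , ys , refl =
  xs ++ (p + m) ∷ ys , add n r xs p ys m<n 1≤r r<m n≡r p≡r g ,
  ↭-trans (shift (p + m) xs ys) (prep (p + m) (drop-∷ (↭-trans (↭-sym (shift p xs ys)) ν↭p∷μ)))

DistinctXm⊆SF : ℕ → ℕ → Set
DistinctXm⊆SF m n = 1 ≤ n → ∀ λs → IsPartition n λs → DistinctXm m λs → λs ∈SF[ n , m ]

module _ {m : ℕ} (1<m : 1 < m) where

  private instance
    m≢0 : NonZero m
    m≢0 = >-nonZero (<⇒≤ 1<m)

  distinctXm-∷-nonMultiple : m ∤ p → DistinctXm m (p ∷ xs) ⇔ (All (m ∣_) xs × DistinctXm m xs)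
  distinctXm-∷-nonMultiple m∤p = mk⇔
    (λ { (apart ∷ distinct) → All.map (xmApart-nonMultiple⇒multiple m∤p) apart , distinct })
    (λ { (multiples , distinct) → All.map (xmApart-nonMultiple-multiple 1<m m∤p) multiples ∷ distinct })

  distinctXm-shape : DistinctXm m xs →
    All (m ∣_) xs ⊎ ∃₂ λ p rest → xs ↭ p ∷ rest × m ∤ p × All (m ∣_) rest
  distinctXm-shape {xs = xs} distinct with multiples-or-nonMultiple m xs
  ... | inj₁ multiples                   = inj₁ multiples
  ... | inj₂ (p , rest , xs↭p∷rest , m∤p) =
    inj₂ (p , rest , xs↭p∷rest , m∤p ,
          proj₁ (Equivalence.to (distinctXm-∷-nonMultiple m∤p) (distinctXm-↭ xs↭p∷rest distinct)))

  distinctXm-∣-sum⇒all-∣ : DistinctXm m xs → m ∣ sum xs → All (m ∣_) xs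
  distinctXm-∣-sum⇒all-∣ distinct m∣sum with distinctXm-shape distinct
  ... | inj₁ multiples = multiples
  ... | inj₂ (p , rest , xs↭p∷rest , m∤p , m∣rest) = contradiction m∣p m∤p
    where
    m∣p+rest : m ∣ sum rest + p
    m∣p+rest = subst (m ∣_) (trans (sum-↭ xs↭p∷rest) (+-comm p (sum rest))) m∣sum
    m∣p : m ∣ p
    m∣p = ∣m+n∣m⇒∣n m∣p+rest (all-∣⇒∣-sum m∣rest)

  distinctXm⇒nonMultiples≤1 : DistinctXm m xs → nonMultiples m xs ≤ 1
  distinctXm⇒nonMultiples≤1 {xs = xs} distinct with distinctXm-shape distinct
  ... | inj₁ multiples = ≤-trans (≤-reflexive (all-∣⇒nonMultiples≡0 multiples)) z≤n
  ... | inj₂ (p , rest , xs↭p∷rest , m∤p , m∣rest) = ≤-reflexive (begin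
    nonMultiples m xs         ≡⟨ nonMultiples-↭ xs↭p∷rest ⟩
    nonMultiples m (p ∷ rest) ≡⟨ nonMultiples-∷-nonMultiple m∤p ⟩
    suc (nonMultiples m rest) ≡⟨ cong suc (all-∣⇒nonMultiples≡0 m∣rest) ⟩
    1                         ∎)
    where open ≡-Reasoning

  gen⇒distinctXm : Gen m n μ → DistinctXm m μ
  gen⇒distinctXm (base n _ _)   = [] ∷ []
  gen⇒distinctXm (mult k μ _ g) = distinctXm-map-*ˡ (gen⇒distinctXm g)
  gen⇒distinctXm (ins n r μ _ 1≤r r<m (q , n≡q*m+r) g) =
    Equivalence.from (distinctXm-∷-nonMultiple (small-nonMultiple 1≤r r<m))
      (distinctXm-∣-sum⇒all-∣ distinct (divides q sum≡q*m) , distinct)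
    where
    distinct : DistinctXm m μ
    distinct = gen⇒distinctXm g
    sum≡q*m : sum μ ≡ q * m
    sum≡q*m = trans (gen-sum g) (trans (cong (_∸ r) n≡q*m+r) (m+n∸n≡m (q * m) r))
  gen⇒distinctXm (add n r xs p ys _ 1≤r r<m _ p≡r g) =
    distinctXm-↭ (↭-sym (shift (p + m) xs ys)) (Equivalence.from (distinctXm-∷-nonMultiple m∤p+m) others)
    where
    m∤p : m ∤ p
    m∤p = residue-nonMultiple 1≤r r<m p≡r
    m∤p+m : m ∤ p + m
    m∤p+m m∣p+m = m∤p (∣m+n∣m⇒∣n (subst (m ∣_) (+-comm p m) m∣p+m) ∣-refl)
    others : All (m ∣_) (xs ++ ys) × DistinctXm m (xs ++ ys)
    others = Equivalence.to (distinctXm-∷-nonMultiple m∤p) (distinctXm-↭ (shift p xs ys) (gen⇒distinctXm g))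

  distinctXm⊆SF-≤ : n ≤ m → DistinctXm⊆SF m n
  distinctXm⊆SF-≤ _ 1≤n [] (_ , 0≡n) _ = contradiction (subst (1 ≤_) (sym 0≡n) 1≤n) λ ()
  distinctXm⊆SF-≤ {n = n} n≤m 1≤n (a ∷ []) (_ , a+0≡n) _ =
    [ n ] , base n 1≤n n≤m , ↭-reflexive (cong [_] (trans (sym a+0≡n) (+-identityʳ a)))
  distinctXm⊆SF-≤ n≤m _ (a ∷ b ∷ rest) (1≤a ∷ 1≤b ∷ _ , sum≡n) ((apart ∷ _) ∷ _) =
    ⊥-elim (nonMultiples-¬xmApart m∤a m∤b apart)
    where
    a+b≤m : a + b ≤ m
    a+b≤m = ≤-trans (+-monoʳ-≤ a (m≤m+n b (sum rest))) (≤-trans (≤-reflexive sum≡n) n≤m)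
    m∤a : m ∤ a
    m∤a = small-nonMultiple 1≤a (<-≤-trans (m<m+n a 1≤b) a+b≤m)
    m∤b : m ∤ b
    m∤b = small-nonMultiple 1≤b (<-≤-trans (m<n+m b 1≤a) a+b≤m)

  distinctXm⊆SF-∣ : <-Rec (DistinctXm⊆SF m) n → m < n → m ∣ n → DistinctXm⊆SF m n
  distinctXm⊆SF-∣ {n = n} ih m<n (divides q n≡q*m) 1≤n λs (positive , sum≡n) distinct
    with all-∣⇒map-*ˡ λs (distinctXm-∣-sum⇒all-∣ distinct (subst (m ∣_) (sym sum≡n) (divides q n≡q*m)))
  ... | μ , refl = subst (λ n → map (m *_) μ ∈SF[ n , m ]) (sym n≡m*q)
                     (∈SF-mult (subst (m <_) n≡m*q m<n) μ∈SF)
    where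
    n≡m*q : n ≡ m * q
    n≡m*q = trans n≡q*m (*-comm q m)
    1≤q : 1 ≤ q
    1≤q = 1≤m*n⇒1≤n m (subst (1 ≤_) n≡m*q 1≤n)
    q<n : q < n
    q<n = <-≤-trans (m<m*n q m {{>-nonZero 1≤q}} 1<m) (≤-reflexive (sym n≡q*m))
    sum≡q : sum μ ≡ q
    sum≡q = *-cancelˡ-≡ (sum μ) q m (trans (sym (sum-map-*ˡ m μ)) (trans sum≡n n≡m*q))
    μ∈SF : μ ∈SF[ q , m ]
    μ∈SF = ih q<n 1≤q μ (All.map (1≤m*n⇒1≤n m) (All.map⁻ positive) , sum≡q)
                        (distinctXm-map-*ˡ⁻¹ distinct)

  distinctXm⊆SF-residue∷ : <-Rec (DistinctXm⊆SF m) n → m < n → 1 ≤ r → r < m → n ≡ r [mod m ] →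
    p ≡ r [mod m ] → IsPartition n (p ∷ rest) → DistinctXm m (p ∷ rest) → (p ∷ rest) ∈SF[ n , m ]
  distinctXm⊆SF-residue∷ {n = n} {r = r} {rest = rest} ih m<n 1≤r r<m n≡r (zero , refl)
    (_ ∷ positive , sum≡n) (_ ∷ distinct) =
    ∈SF-ins m<n 1≤r r<m n≡r (ih n∸r<n (m<n⇒0<n∸m r<n) rest (positive , sum≡n∸r) distinct)
    where
    r<n : r < n
    r<n = <-trans r<m m<n
    n∸r<n : n ∸ r < n
    n∸r<n = ∸-monoʳ-< 1≤r (<⇒≤ r<n)
    sum≡n∸r : sum rest ≡ n ∸ r
    sum≡n∸r = trans (sym (m+n∸m≡n r (sum rest))) (cong (_∸ r) sum≡n)
  distinctXm⊆SF-residue∷ {n = n} {r = r} {rest = rest} ih m<n 1≤r r<m n≡r p≡r@(suc q , refl)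
    (_ ∷ positive , sum≡n) distinct =
    subst (λ p → (p ∷ rest) ∈SF[ n , m ]) p′+m≡p (∈SF-add m<n 1≤r r<m n≡r (q , refl) p′∷rest∈SF)
    where
    p′ : ℕ
    p′ = q * m + r
    p′+m≡p : p′ + m ≡ suc q * m + r
    p′+m≡p = trans (xy∙z≈xz∙y (q * m) r m) (cong (_+ r) (+-comm (q * m) m))
    sum≡n∸m : p′ + sum rest ≡ n ∸ m
    sum≡n∸m = begin
      p′ + sum rest                ≡⟨ m+n∸n≡m (p′ + sum rest) m ⟨
      p′ + sum rest + m ∸ m        ≡⟨ cong (_∸ m) (xy∙z≈xz∙y p′ (sum rest) m) ⟩
      p′ + m + sum rest ∸ m        ≡⟨ cong (λ p → p + sum rest ∸ m) p′+m≡p ⟩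
      suc q * m + r + sum rest ∸ m ≡⟨ cong (_∸ m) sum≡n ⟩
      n ∸ m                        ∎
      where open ≡-Reasoning
    distinct′ : DistinctXm m (p′ ∷ rest)
    distinct′ =
      Equivalence.from (distinctXm-∷-nonMultiple (residue-nonMultiple 1≤r r<m (q , refl)))
        (Equivalence.to (distinctXm-∷-nonMultiple (residue-nonMultiple 1≤r r<m p≡r)) distinct)
    p′∷rest∈SF : (p′ ∷ rest) ∈SF[ n ∸ m , m ]
    p′∷rest∈SF = ih (∸-monoʳ-< (<⇒≤ 1<m) (<⇒≤ m<n)) (m<n⇒0<n∸m m<n) (p′ ∷ rest)
      (≤-trans 1≤r (m≤n+m r (q * m)) ∷ positive , sum≡n∸m) distinct′

  distinctXm⊆SF-residue : <-Rec (DistinctXm⊆SF m) n → m < n → 1 ≤ r → r < m →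
                           n ≡ r [mod m ] → DistinctXm⊆SF m n
  distinctXm⊆SF-residue {n = n} {r = r} ih m<n 1≤r r<m n≡r 1≤n λs partition@(_ , sum≡n) distinct
    with distinctXm-shape distinct
  ... | inj₁ multiples =
    contradiction (subst (m ∣_) sum≡n (all-∣⇒∣-sum multiples)) (residue-nonMultiple 1≤r r<m n≡r)
  ... | inj₂ (p , rest , λs↭p∷rest , _ , multiples) with all-∣⇒∣-sum multiples
  ...   | divides t sum≡t*m =
    ∈SF-↭ (distinctXm⊆SF-residue∷ ih m<n 1≤r r<m n≡r p≡r partition′ (distinctXm-↭ λs↭p∷rest distinct))
          (↭-sym λs↭p∷rest)
    where
    partition′ : IsPartition n (p ∷ rest)
    partition′ = isPartition-↭ λs↭p∷rest partition
    n≡p+t*m : n ≡ p + t * m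
    n≡p+t*m = trans (sym (proj₂ partition′)) (cong (p +_) sum≡t*m)
    p≡r : p ≡ r [mod m ]
    p≡r = residue-+-multiple {k = t} r<m (subst (_≡ r [mod m ]) n≡p+t*m n≡r)

  distinctXm⊆SF : ∀ n → DistinctXm⊆SF m n
  distinctXm⊆SF = <-rec (DistinctXm⊆SF m) step
    where
    step : ∀ n → <-Rec (DistinctXm⊆SF m) n → DistinctXm⊆SF m n
    step n ih with n ≤? m
    ... | yes n≤m = distinctXm⊆SF-≤ n≤m
    ... | no  n≰m with n % m | ≡[mod]-% {m = m} n | m%n<n n m
    ...   | zero  | q , n≡q*m+0 | _   =
      distinctXm⊆SF-∣ ih (≰⇒> n≰m) (divides q (trans n≡q*m+0 (+-identityʳ _)))
    ...   | suc _ | n≡r         | r<m =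
      distinctXm⊆SF-residue ih (≰⇒> n≰m) (s≤s z≤n) r<m n≡r

theorem4 : (m n : ℕ) → 1 < m → 1 ≤ n → (λs : List ℕ) → IsPartition n λs →
    (λs ∈SF[ n , m ] ⇔ (DistinctXm m λs × nonMultiples m λs ≤ 1))
theorem4 m n 1<m 1≤n λs partition = mk⇔
  (λ { (μ , g , μ↭λs) → conditions (distinctXm-↭ μ↭λs (gen⇒distinctXm 1<m g)) })
  (λ { (distinct , _) → distinctXm⊆SF 1<m n 1≤n λs partition distinct })
  where
  conditions : DistinctXm m λs → DistinctXm m λs × nonMultiples m λs ≤ 1
  conditions distinct = distinct , distinctXm⇒nonMultiples≤1 1<m distinct
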